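{- Let $P$ be a finite ranked poset with a unique minimal element $\hat{0}$ and rank function $\rho$, and let $\sim$ be an equivalence relation on $P$ such that $P/\sim$ is a homogeneous quotient. Suppose that for all $x,y\in P$, $x\sim y$ implies $\rho(x)=\rho(y)$. Then $P/\sim$ is ranked and its rank function satisfies $\rho(X)=\rho(x)$ for every equivalence class $X$ and every $x\in X$.
   Context: A poset with minimum $\hat{0}$ is ranked if for each $x$ all saturated $\hat{0}$--$x$ chains have the same length; $\rho(x)$ is that length. For an equivalence relation $\sim$ on $P$, the quotient $P/\sim$ is the set of equivalence classes with $X\leq Y$ iff $x\leq y$ in $P$ for some $x\in X$, $y\in Y$. It is a homogeneous quotient if (1) $\{\hat{0}\}$ is an equivalence class, and (2) whenever $X\leq Y$, for every $x\in X$ there is $y\in Y$ with $x\leq y$; then $P/\sim$ is a poset. -}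

module Defs where

open import Data.Nat using (ℕ; zero; suc)
open import Data.Fin using (Fin)
open import Data.Product using (Σ; _×_; ∃)
open import Data.Empty using (⊥)
open import Relation.Nullary using (¬_)
open import Relation.Binary.PropositionalEquality using (_≡_)
open import Relation.Binary.Core using (Rel)
open import Level using (0ℓ)
open import Relation.Binary.Structures using (IsPartialOrder; IsEquivalence)

-- Generic order-theoretic notions for a carrier A with an equality _≈_
-- (for P itself _≈_ is _≡_; for the quotient P/∼ it is ∼, elements of
-- A standing as representatives of their classes) and an order _≤_.
module Order {A : Set} (_≈_ : Rel A 0ℓ) (_≤_ : Rel A 0ℓ) where

  _<_ : Rel A 0ℓ
  x < y = x ≤ y × ¬ (x ≈ y)

  _⋖_ : Rel A 0ℓ
  x ⋖ y = x < y × (∀ z → x < z → z < y → ⊥)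

  data SatChain : A → A → ℕ → Set where
    done : ∀ {a b} → a ≈ b → SatChain a b zero
    step : ∀ {a c b k} → a ⋖ c → SatChain c b k → SatChain a b (suc k)

  IsMinimum : A → Set
  IsMinimum z = ∀ x → z ≤ x

  IsRankFunction : A → (A → ℕ) → Set
  IsRankFunction z ρ =
    (∀ x → SatChain z x (ρ x)) × (∀ x k → SatChain z x k → k ≡ ρ x)

  Ranked : A → Set
  Ranked z = IsMinimum z × Σ (A → ℕ) (IsRankFunction z)

-- The order on P/∼, with classes represented by elements of P:
-- [a] ≤ [b] iff x ≤ y for some x ∼ a, y ∼ b.
QuotLe : ∀ {n} → Rel (Fin n) 0ℓ → Rel (Fin n) 0ℓ → Rel (Fin n) 0ℓ
QuotLe _≤_ _∼_ a b = Σ _ λ x → Σ _ λ y → x ∼ a × y ∼ b × x ≤ y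

IsHomogeneous : ∀ {n} → Rel (Fin n) 0ℓ → Rel (Fin n) 0ℓ → Fin n → Set
IsHomogeneous _≤_ _∼_ z =
  (∀ x → x ∼ z → x ≡ z)
  × (∀ a b → QuotLe _≤_ _∼_ a b → ∀ x → x ∼ a → Σ _ λ y → y ∼ b × x ≤ y)

-- Covers of P stay covers in P/∼ and covers of P/∼ still raise ρ by one, so
-- saturated chains of P and of P/∼ have the same lengths.  Both directions
-- rest on ρ being strictly monotone on P and on homogeneity, which lifts a
-- relation X ≤ Y of classes to any chosen representative of X.
module Submission where

open import Defs
open import Data.Nat using (ℕ)
open import Data.Fin using (Fin)
open import Data.Product using (_×_)
open import Relation.Binary.PropositionalEquality using (_≡_)
open import Relation.Binary.Core using (Rel)
open import Level using (0ℓ)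
open import Relation.Binary.Structures using (IsPartialOrder; IsEquivalence)

open import Data.Nat using (suc; _+_) renaming (_≤_ to _≤ℕ_; _<_ to _<ℕ_)
open import Data.Nat.Properties
  using (<-irrefl; <⇒≤; <-≤-trans; ≤-reflexive; +-suc; +-identityʳ; module ≤-Reasoning)
  renaming (_≟_ to _≟ℕ_; _<?_ to _<ℕ?_)
open import Data.Fin.Properties using (_≟_)
open import Data.Fin.Induction using (po-wellFounded; po-noetherian)
open import Data.Product using (∃; _,_; proj₁; proj₂)
open import Data.Empty using (⊥)
open import Function using (flip)
open import Induction.WellFounded using (Acc; acc)
open import Relation.Nullary using (¬_; yes; no)
open import Relation.Nullary.Decidable using (decidable-stable)
open import Relation.Binary.PropositionalEquality using (refl; sym; trans; cong; module ≡-Reasoning)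

module RankedFinitePoset {n} {_≤_ : Rel (Fin n) 0ℓ} (isPO : IsPartialOrder _≡_ _≤_)
  {z : Fin n} {ρ : Fin n → ℕ} (isRank : Order.IsRankFunction _≡_ _≤_ z ρ) where

  open IsPartialOrder isPO using () renaming (refl to ≤-refl; trans to ≤-trans)
  open Order _≡_ _≤_

  rank-minimum : ρ z ≡ 0
  rank-minimum = sym (proj₂ isRank z 0 (done refl))

  SatChain-snoc : ∀ {a b c k} → SatChain a b k → b ⋖ c → SatChain a c (suc k)
  SatChain-snoc (done refl) b⋖c = step b⋖c (done refl)
  SatChain-snoc (step a⋖d d⇝b) b⋖c = step a⋖d (SatChain-snoc d⇝b b⋖c)

  ⋖⇒rank-suc : ∀ {a c} → a ⋖ c → ρ c ≡ suc (ρ a)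
  ⋖⇒rank-suc {a} {c} a⋖c = sym (proj₂ isRank c _ (SatChain-snoc (proj₁ isRank a) a⋖c))

  -- Finiteness enters here: a minimal element of {c | x < c ≤ y} covers x.
  -- Without decidability of _≤_ the cover is only obtained up to ¬¬.
  ¬¬-⋖-below : ∀ {x y} → x < y → ¬ ¬ ∃ λ w → x ⋖ w × w ≤ y
  ¬¬-⋖-below {x} {y} x<y noCover = noCandidate (po-wellFounded isPO y) x<y ≤-refl
    where
    noCandidate : ∀ {c} → Acc _<_ c → x < c → c ≤ y → ⊥
    noCandidate {c} (acc below) x<c c≤y =
      noCover (c , (x<c , λ w x<w w<c → noCandidate (below w<c) x<w (≤-trans (proj₁ w<c) c≤y)) , c≤y)

  <⇒rank< : ∀ {x y} → x < y → ρ x <ℕ ρ y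
  <⇒rank< {x} {y} = go (po-noetherian isPO x)
    where
    go : ∀ {x} → Acc (flip _<_) x → x < y → ρ x <ℕ ρ y
    go {x} (acc above) x<y = decidable-stable (ρ x <ℕ? ρ y) λ ρx≮ρy →
      ¬¬-⋖-below x<y λ (w , x⋖w , w≤y) →
        ρx≮ρy (<-≤-trans (≤-reflexive (sym (⋖⇒rank-suc x⋖w))) (ρw≤ρy x⋖w w≤y))
      where
      ρw≤ρy : ∀ {w} → x ⋖ w → w ≤ y → ρ w ≤ℕ ρ y
      ρw≤ρy {w} x⋖w w≤y with w ≟ y
      ... | yes refl = ≤-reflexive refl
      ... | no w≢y = <⇒≤ (go (above (proj₁ x⋖w)) (w≤y , w≢y))

module HomogeneousQuotient {n} {_≤_ : Rel (Fin n) 0ℓ} (isPO : IsPartialOrder _≡_ _≤_)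
  {z : Fin n} {ρ : Fin n → ℕ} (isRank : Order.IsRankFunction _≡_ _≤_ z ρ)
  {_∼_ : Rel (Fin n) 0ℓ} (isEq : IsEquivalence _∼_)
  (homogeneous : ∀ a b → QuotLe _≤_ _∼_ a b → ∀ x → x ∼ a → ∃ λ y → y ∼ b × x ≤ y)
  (∼⇒rank≡ : ∀ {x y} → x ∼ y → ρ x ≡ ρ y) where

  open IsEquivalence isEq using () renaming (refl to ∼-refl; sym to ∼-sym; trans to ∼-trans)
  open RankedFinitePoset isPO isRank
  open Order _≡_ _≤_
  module Q = Order _∼_ (QuotLe _≤_ _∼_)

  ⋖⇒<Q : ∀ {a c} → a ⋖ c → a Q.< c
  ⋖⇒<Q {a} {c} a⋖c@((a≤c , _) , _) =
    (a , c , ∼-refl , ∼-refl , a≤c) , λ a∼c → <-irrefl (∼⇒rank≡ a∼c) (≤-reflexive (sym (⋖⇒rank-suc a⋖c)))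

  -- Homogeneity lifts a <Q d <Q c to a < d′ < c′ in P with d′ ∼ d and c′ ∼ c,
  -- leaving no room between the ranks ρ a and ρ c = 1 + ρ a.
  ⋖⇒⋖Q : ∀ {a c} → a ⋖ c → a Q.⋖ c
  ⋖⇒⋖Q {a} {c} a⋖c = ⋖⇒<Q a⋖c , noMiddle
    where
    noMiddle : ∀ d → a Q.< d → d Q.< c → ⊥
    noMiddle d (a≤Qd , a≁d) (d≤Qc , d≁c) with homogeneous a d a≤Qd a ∼-refl
    ... | d′ , d′∼d , a≤d′ with homogeneous d c d≤Qc d′ d′∼d
    ... | c′ , c′∼c , d′≤c′ = <-irrefl refl (begin-strict
      suc (ρ a)  ≤⟨ <⇒rank< (a≤d′ , λ { refl → a≁d d′∼d }) ⟩
      ρ d′       <⟨ <⇒rank< (d′≤c′ , λ { refl → d≁c (∼-trans (∼-sym d′∼d) c′∼c) }) ⟩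
      ρ c′       ≡⟨ ∼⇒rank≡ c′∼c ⟩
      ρ c        ≡⟨ ⋖⇒rank-suc a⋖c ⟩
      suc (ρ a)  ∎)
      where open ≤-Reasoning

  -- A cover a ⋖ w below a lift c′ of c lies strictly below c in the quotient
  -- unless w ∼ c, and the former contradicts a ⋖Q c.
  ⋖Q⇒rank-suc : ∀ {a c} → a Q.⋖ c → ρ c ≡ suc (ρ a)
  ⋖Q⇒rank-suc {a} {c} ((a≤Qc , a≁c) , noMiddle) with homogeneous a c a≤Qc a ∼-refl
  ... | c′ , c′∼c , a≤c′ = decidable-stable (ρ c ≟ℕ suc (ρ a)) λ ρc≢ →
    ¬¬-⋖-below (a≤c′ , λ { refl → a≁c c′∼c }) λ (w , a⋖w , w≤c′) →
      noMiddle w (⋖⇒<Q a⋖w)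
        ((w , c′ , ∼-refl , c′∼c , w≤c′) , λ w∼c → ρc≢ (trans (sym (∼⇒rank≡ w∼c)) (⋖⇒rank-suc a⋖w)))

  SatChain⇒SatChainQ : ∀ {a b k} → SatChain a b k → Q.SatChain a b k
  SatChain⇒SatChainQ (done refl) = Q.done ∼-refl
  SatChain⇒SatChainQ (step a⋖c c⇝b) = Q.step (⋖⇒⋖Q a⋖c) (SatChain⇒SatChainQ c⇝b)

  SatChainQ⇒rank≡ : ∀ {a b k} → Q.SatChain a b k → ρ b ≡ k + ρ a
  SatChainQ⇒rank≡ (Q.done a∼b) = sym (∼⇒rank≡ a∼b)
  SatChainQ⇒rank≡ {a} {b} {suc k} (Q.step {c = c} a⋖c c⇝b) = begin
    ρ b            ≡⟨ SatChainQ⇒rank≡ c⇝b ⟩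
    k + ρ c        ≡⟨ cong (k +_) (⋖Q⇒rank-suc a⋖c) ⟩
    k + suc (ρ a)  ≡⟨ +-suc k (ρ a) ⟩
    suc k + ρ a    ∎
    where open ≡-Reasoning

  SatChainQ-from-minimum : ∀ {x k} → Q.SatChain z x k → k ≡ ρ x
  SatChainQ-from-minimum {x} {k} z⇝x = begin
    k          ≡⟨ +-identityʳ k ⟨
    k + 0      ≡⟨ cong (k +_) rank-minimum ⟨
    k + ρ z    ≡⟨ SatChainQ⇒rank≡ z⇝x ⟨
    ρ x        ∎
    where open ≡-Reasoning

lemma2p5 : (n : ℕ) (_≤_ : Rel (Fin n) 0ℓ) → IsPartialOrder _≡_ _≤_
    → (z : Fin n) → Order.IsMinimum _≡_ _≤_ z
    → (ρ : Fin n → ℕ) → Order.IsRankFunction _≡_ _≤_ z ρ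
    → (_∼_ : Rel (Fin n) 0ℓ) → IsEquivalence _∼_
    → IsHomogeneous _≤_ _∼_ z
    → (∀ x y → x ∼ y → ρ x ≡ ρ y)
    → Order.IsMinimum _∼_ (QuotLe _≤_ _∼_) z
      × Order.IsRankFunction _∼_ (QuotLe _≤_ _∼_) z ρ
lemma2p5 n _≤_ isPO z isMin ρ isRank _∼_ isEq (_ , homogeneous) ∼⇒rank≡ =
  (λ x → z , x , ∼-refl , ∼-refl , isMin x) ,
  (λ x → SatChain⇒SatChainQ (proj₁ isRank x)) ,
  (λ x k → SatChainQ-from-minimum)
  where
  open IsEquivalence isEq using () renaming (refl to ∼-refl)
  open HomogeneousQuotient isPO isRank isEq homogeneous (∼⇒rank≡ _ _)
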